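{- Let $p$ be a prime, let $a_1$ be an integer, and let $r$ be an integer. Let $\delta$ be the distance from $a_1/\sqrt{p}$ to the nearest integer congruent to $0 \bmod 4$. Set $$B_{\mathrm{low}}=-p+\frac{a_1^2-p\delta^2}{2},\qquad B_{\mathrm{high}}=3p+\frac{a_1^2}{3}.$$ Then there are at most $6$ integers $a_2$ with $a_2\equiv r \pmod p$ and $B_{\mathrm{low}}\le a_2\le B_{\mathrm{high}}$.
   Context: Motivation only: if $C$ is a genus $3$ curve over $\mathbb{F}_p$ with $L$-polynomial $p^3T^6+p^2a_1T^5+pa_2T^4+a_3T^3+a_2T^2+a_1T+1$, then $a_2$ lies in $[B_{\mathrm{low}},B_{\mathrm{high}}]$ (a known bound). Consequently, once $a_1$ and $a_2\bmod p$ are known, at most $6$ choices for $a_2$ remain. -}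

module Defs where

open import Data.Nat as ℕ using (ℕ)
open import Data.Integer using (ℤ; +_; _+_; _-_; _*_; _≤_; _<_)
open import Data.Integer.Divisibility using (_∣_)
open import Data.Product using (_×_)
open import Data.Sum using (_⊎_)

-- MulSqrtLe x n y  means the real inequality  x · √n ≤ y  (x, y ∈ ℤ, n ∈ ℕ),
-- decided exactly by case analysis on signs and comparing squares.
MulSqrtLe : ℤ → ℕ → ℤ → Set
MulSqrtLe x n y =
    (x ≤ + 0 × + 0 ≤ y)
  ⊎ (x ≤ + 0 × y < + 0 × y * y ≤ x * x * + n)
  ⊎ (+ 0 < x × + 0 ≤ y × x * x * + n ≤ y * y)

-- Since p δ² = min_m (a1 - m√p)², B_low = max_m (-p + (a1² - (a1 - m√p)²)/2),
-- so B_low ≤ a2  iff for every m with 4 ∣ m: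
--   a1² - (a1 - m√p)² ≤ 2a2 + 2p,  i.e.  (2 a1 m)·√p ≤ 2a2 + 2p + m² p.
LowOK : ℕ → ℤ → ℤ → Set
LowOK p a1 a2 = ∀ (m : ℤ) → + 4 ∣ m →
  MulSqrtLe (+ 2 * a1 * m) p (+ 2 * a2 + + 2 * + p + m * m * + p)

HighOK : ℕ → ℤ → ℤ → Set
HighOK p a1 a2 = + 3 * a2 ≤ + 9 * + p + a1 * a1

Admissible : ℕ → ℤ → ℤ → ℤ → Set
Admissible p a1 r a2 = (+ p ∣ a2 - r) × LowOK p a1 a2 × HighOK p a1 a2

{-# OPTIONS --safe #-}
module Submission where

-- Let n = |a1| and let M be the multiple of 4 nearest to n/√p, so |n - M√p| ≤ 2√p.
-- The bound B_low ≤ a2 at this M reads 2a2 + 2p ≥ n² - (n - M√p)² ≥ n² - 4p, so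
-- 3a2 + 9p ≥ 3n²/2 > a1² (for n = 0 take M = 0).  With 3a2 ≤ 9p + a1² this confines
-- 3a2 to a half-open interval of length 18p, which holds at most 6 values of
-- a2 ≡ r (mod p).  As √p is irrational, the middle step is checked after squaring:
-- it becomes (2n² + 3(M² - 4)p)² < 36 n² M² p, a concave quadratic inequality in n²
-- that holds on the whole range (M - 2)²p ≤ n² ≤ (M + 2)²p once M ≥ 4.

open import Defs
open import Data.List using (List; []; _∷_; length; map; applyUpTo)
open import Data.List.Membership.Propositional using (_∈_; _─_)
open import Data.List.Membership.Propositional.Properties using (∈-map⁺; ∈-applyUpTo⁺)
open import Data.Product using (∃-syntax; _×_; _,_)
open import Data.Sum using (_⊎_; inj₁; inj₂)
open import Relation.Nullary using (¬_; yes; no; contradiction)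
open import Relation.Unary using (Pred; Decidable)
open import Relation.Binary.PropositionalEquality

module ℕ-Bounds where
  open import Data.Nat
  open import Data.Nat.Properties
  open import Data.Nat.Divisibility using (_∣_; divides)
  open import Data.Nat.Tactic.RingSolver using (solve-∀)

  crossing : ∀ {ℓ} {P : Pred ℕ ℓ} → Decidable P → P 0 → ∀ n → ¬ P n → ∃[ k ] P k × ¬ P (suc k)
  crossing P? P0 zero    ¬Pn    = contradiction P0 ¬Pn
  crossing P? P0 (suc n) ¬P1+n with P? n
  ... | yes Pn  = n , Pn , ¬P1+n
  ... | no  ¬Pn = crossing P? P0 n ¬Pn

  m*m<n*n⇒m<n : ∀ {m n} → m * m < n * n → m < n
  m*m<n*n⇒m<n m*m<n*n = ≰⇒> λ n≤m → <⇒≱ m*m<n*n (*-mono-≤ n≤m n≤m)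

  squares-bound : ∀ {e p N y} → 0 < e → 0 < p →
    e * e * p ≤ N → N ≤ (4 + e) * (4 + e) * p →
    4 * N * ((2 + e) * (2 + e)) * p ≤ y * y →
    2 * N + 3 * ((e * e + 4 * e) * p) < 3 * y
  squares-bound {e} {p} {y = y} z<s z<s lo hi sq with m≤n⇒∃[o]m+o≡n lo
  ... | A , refl = m*m<n*n⇒m<n (begin-strict
      R * R                                   <⟨ +-cancelʳ-< (4 * A * A) _ _ R²+4A²<S+4A² ⟩
      S                                       ≡⟨ nine-times ((2 + e) * (2 + e)) N p ⟩
      9 * (4 * N * ((2 + e) * (2 + e)) * p)   ≤⟨ *-monoʳ-≤ 9 sq ⟩
      9 * (y * y)                             ≡⟨ square-of-triple y ⟩
      3 * y * (3 * y)                         ∎)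
    where
    open ≤-Reasoning
    N = e * e * p + A
    B = 4 * p * ((3 + e) * (3 + e))
    R = 2 * N + 3 * ((e * e + 4 * e) * p)
    S = 36 * N * ((2 + e) * (2 + e)) * p
    K = p * p * (e * e * e) * (11 * e + 24)
    nine-times : ∀ M N p → 36 * N * M * p ≡ 9 * (4 * N * M * p)
    nine-times = solve-∀
    square-of-triple : ∀ y → 9 * (y * y) ≡ 3 * y * (3 * y)
    square-of-triple = solve-∀
    -- S - R² = K + 4A(B - A): the concave quadratic in A stays above K > 0 while A ≤ B.
    square-gap : ∀ e p A → let N = e * e * p + A in
      36 * N * ((2 + e) * (2 + e)) * p + 4 * A * A
        ≡ ((2 * N + 3 * ((e * e + 4 * e) * p)) * (2 * N + 3 * ((e * e + 4 * e) * p))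
           + p * p * (e * e * e) * (11 * e + 24))
          + 4 * A * (4 * p * ((3 + e) * (3 + e)))
    square-gap = solve-∀
    width : ∀ e p → e * e * p + 4 * p * ((3 + e) * (3 + e))
                  ≡ (4 + e) * (4 + e) * p + 4 * p * (e * e + 4 * e + 5)
    width = solve-∀
    A≤B : A ≤ B
    A≤B = +-cancelˡ-≤ (e * e * p) A B (begin
      e * e * p + A                                       ≤⟨ hi ⟩
      (4 + e) * (4 + e) * p                               ≤⟨ m≤m+n _ _ ⟩
      (4 + e) * (4 + e) * p + 4 * p * (e * e + 4 * e + 5) ≡⟨ width e p ⟨
      e * e * p + B                                       ∎)
    R²+4A²<S+4A² : R * R + 4 * A * A < S + 4 * A * A
    R²+4A²<S+4A² = subst (R * R + 4 * A * A <_) (sym (square-gap e p A))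
      (+-mono-<-≤ (m<m+n (R * R) {K} z<s) (*-monoʳ-≤ (4 * A) A≤B))

  n*n<[2+4n]*[2+4n]*p : ∀ n {p} → 0 < p → n * n < (2 + 4 * n) * (2 + 4 * n) * p
  n*n<[2+4n]*[2+4n]*p n {p@(suc _)} _ = <-≤-trans (*-mono-< n<2+4n n<2+4n) (m≤m*n _ p)
    where
    n<2+4n : n < 2 + 4 * n
    n<2+4n = s≤s (m≤n⇒m≤1+n (m≤n*m n 4))

  nearest-multiple-of-4 : ∀ n {p} → 0 < p →
    n * n < 4 * p ⊎ ∃[ k ] let e = 2 + 4 * k in e * e * p ≤ n * n × n * n < (4 + e) * (4 + e) * p
  nearest-multiple-of-4 n {p} 0<p with 2 * 2 * p ≤? n * n
  ... | no  4p≰n² = inj₁ (≰⇒> 4p≰n²)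
  ... | yes 4p≤n² with crossing (λ k → (2 + 4 * k) * (2 + 4 * k) * p ≤? n * n) 4p≤n² n
                                (<⇒≱ (n*n<[2+4n]*[2+4n]*p n 0<p))
  ...   | k , lo , ¬hi =
    inj₂ (k , lo , ≰⇒> (subst (λ e → e * e * p ≰ n * n) (2+4[1+k]≡4+[2+4k] k) ¬hi))
    where
    2+4[1+k]≡4+[2+4k] : ∀ k → 2 + 4 * suc k ≡ 4 + (2 + 4 * k)
    2+4[1+k]≡4+[2+4k] = solve-∀

  -- M is the multiple of 4 nearest to n/√p; the hypothesis on y is 2nM√p ≤ y, squared.
  multiple-of-4-bound : ∀ n {p} → 0 < p → ∃[ M ] 4 ∣ M ×
    (∀ y → 2 * (n * M) * (2 * (n * M)) * p ≤ y * y →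
           2 * (n * n) + 3 * (M * M * p) < 3 * y + 12 * p)
  multiple-of-4-bound n {p} 0<p with nearest-multiple-of-4 n 0<p
  ... | inj₁ n²<4p = 0 , divides 0 refl , λ y _ → begin-strict
    2 * (n * n) + 0               ≡⟨ +-identityʳ _ ⟩
    2 * (n * n)                   <⟨ *-monoʳ-< 2 n²<4p ⟩
    2 * (4 * p)                   ≤⟨ m≤m+n _ _ ⟩
    2 * (4 * p) + (3 * y + 4 * p) ≡⟨ regroup y p ⟩
    3 * y + 12 * p                ∎
    where
    open ≤-Reasoning
    regroup : ∀ y p → 2 * (4 * p) + (3 * y + 4 * p) ≡ 3 * y + 12 * p
    regroup = solve-∀
  ... | inj₂ (k , lo , hi) = 2 + e , divides (1 + k) (M≡[1+k]*4 k) , bound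
    where
    e = 2 + 4 * k
    M≡[1+k]*4 : ∀ k → 2 + (2 + 4 * k) ≡ (1 + k) * 4
    M≡[1+k]*4 = solve-∀
    split-square : ∀ N e p → 2 * N + 3 * ((2 + e) * (2 + e) * p)
                           ≡ 2 * N + 3 * ((e * e + 4 * e) * p) + 12 * p
    split-square = solve-∀
    expand : ∀ n M p → 2 * (n * M) * (2 * (n * M)) * p ≡ 4 * (n * n) * (M * M) * p
    expand = solve-∀
    bound : ∀ y → 2 * (n * (2 + e)) * (2 * (n * (2 + e))) * p ≤ y * y →
      2 * (n * n) + 3 * ((2 + e) * (2 + e) * p) < 3 * y + 12 * p
    bound y sq = begin-strict
      2 * (n * n) + 3 * ((2 + e) * (2 + e) * p)         ≡⟨ split-square (n * n) e p ⟩
      2 * (n * n) + 3 * ((e * e + 4 * e) * p) + 12 * p  <⟨ +-monoˡ-< (12 * p) R<3y ⟩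
      3 * y + 12 * p                                     ∎
      where
      open ≤-Reasoning
      R<3y : 2 * (n * n) + 3 * ((e * e + 4 * e) * p) < 3 * y
      R<3y = squares-bound {e} {p} {n * n} {y} z<s 0<p lo (<⇒≤ hi)
               (subst (_≤ y * y) (expand n (2 + e) p) sq)

module ℤ-Bounds where
  open import Data.Integer
  open import Data.Integer.Properties
  open import Data.Integer.DivMod using (_/ℕ_; [n/ℕd]*d≤n; n<s[n/ℕd]*d)
  open import Data.Integer.Divisibility.Signed using (divides; ∣ᵤ⇒∣)
  open import Data.Integer.Tactic.RingSolver using (solve-∀)
  import Data.Nat as ℕ
  import Data.Nat.Properties as ℕ
  import Data.Nat.Divisibility as ℕ using (_∣_)
  open import Data.Integer.Divisibility using (_∣_)
  import Data.Sign as Sign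
  import Data.Sign.Properties as Sign
  open ℕ-Bounds using (multiple-of-4-bound)

  +-cancelʳ-< : ∀ {i j} k → i + k < j + k → i < j
  +-cancelʳ-< {i} {j} k i+k<j+k = subst₂ _<_ (i+k-k≡i i k) (i+k-k≡i j k) (+-monoˡ-< (- k) i+k<j+k)
    where
    i+k-k≡i : ∀ i k → i + k - k ≡ i
    i+k-k≡i = solve-∀

  s◃m*s◃n≡+m*n : ∀ s m n → (s ◃ m) * (s ◃ n) ≡ + (m ℕ.* n)
  s◃m*s◃n≡+m*n s m n = begin
    (s ◃ m) * (s ◃ n)       ≡⟨ ◃-distrib-* s s m n ⟨
    (s Sign.* s) ◃ (m ℕ.* n) ≡⟨ cong (_◃ (m ℕ.* n)) (Sign.s*s≡+ s) ⟩
    Sign.+ ◃ (m ℕ.* n)       ≡⟨ +◃n≡+n (m ℕ.* n) ⟩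
    + (m ℕ.* n)              ∎
    where open ≡-Reasoning

  i*[sign[i]◃n]≡+∣i∣*n : ∀ i n → i * (sign i ◃ n) ≡ + (∣ i ∣ ℕ.* n)
  i*[sign[i]◃n]≡+∣i∣*n i n =
    trans (cong (_* (sign i ◃ n)) (sym (◃-inverse i))) (s◃m*s◃n≡+m*n (sign i) ∣ i ∣ n)

  pos-linear : ∀ a b c d → + (a ℕ.* b ℕ.+ c ℕ.* d) ≡ + a * + b + + c * + d
  pos-linear a b c d = trans (pos-+ (a ℕ.* b) (c ℕ.* d)) (cong₂ _+_ (pos-* a b) (pos-* c d))

  MulSqrtLe-+ : ∀ {x n y} → MulSqrtLe (+ x) n y → ∃[ z ] y ≡ + z × x ℕ.* x ℕ.* n ℕ.≤ z ℕ.* z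
  MulSqrtLe-+ (inj₁ (+≤+ ℕ.z≤n , +≤+ _)) = _ , refl , ℕ.z≤n
  MulSqrtLe-+ (inj₂ (inj₁ (+≤+ ℕ.z≤n , -<+ , +≤+ ())))
  MulSqrtLe-+ {x} {n} (inj₂ (inj₂ (_ , +≤+ {n = z} _ , x²n≤z²))) =
    z , refl , drop‿+≤+ (subst₂ _≤_ pos-x²n (sym (pos-* z z)) x²n≤z²)
    where
    pos-x²n : + x * + x * + n ≡ + (x ℕ.* x ℕ.* n)
    pos-x²n = trans (cong (_* + n) (sym (pos-* x x))) (sym (pos-* (x ℕ.* x) n))

  -- LowOK at m = sign a1 ◃ M, which makes a1 * m = |a1| M nonnegative.
  LowOK⇒MulSqrtLe-at : ∀ {p a1 a2 M} → LowOK p a1 a2 → 4 ℕ.∣ M →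
    ∃[ z ] + 2 * a2 + + 2 * + p + + (M ℕ.* M ℕ.* p) ≡ + z
         × 2 ℕ.* (∣ a1 ∣ ℕ.* M) ℕ.* (2 ℕ.* (∣ a1 ∣ ℕ.* M)) ℕ.* p ℕ.≤ z ℕ.* z
  LowOK⇒MulSqrtLe-at {p} {a1} {a2} {M} low 4∣M =
    MulSqrtLe-+ (subst₂ (λ x y → MulSqrtLe x p y) x≡ y≡ (low m 4∣m))
    where
    m = sign a1 ◃ M
    4∣m : + 4 ∣ m
    4∣m = subst (4 ℕ.∣_) (sym (abs-◃ (sign a1) M)) 4∣M
    x≡ : + 2 * a1 * m ≡ + (2 ℕ.* (∣ a1 ∣ ℕ.* M))
    x≡ = begin
      + 2 * a1 * m               ≡⟨ *-assoc (+ 2) a1 m ⟩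
      + 2 * (a1 * m)             ≡⟨ cong (+ 2 *_) (i*[sign[i]◃n]≡+∣i∣*n a1 M) ⟩
      + 2 * + (∣ a1 ∣ ℕ.* M)     ≡⟨ pos-* 2 (∣ a1 ∣ ℕ.* M) ⟨
      + (2 ℕ.* (∣ a1 ∣ ℕ.* M))   ∎
      where open ≡-Reasoning
    y≡ : + 2 * a2 + + 2 * + p + m * m * + p ≡ + 2 * a2 + + 2 * + p + + (M ℕ.* M ℕ.* p)
    y≡ = cong (λ s → + 2 * a2 + + 2 * + p + s)
      (trans (cong (_* + p) (s◃m*s◃n≡+m*n (sign a1) M M)) (sym (pos-* (M ℕ.* M) p)))

  LowOK⇒a1²<3a2+9p : ∀ {p} → 0 ℕ.< p → ∀ a1 a2 → LowOK p a1 a2 → a1 * a1 < + 3 * a2 + + 9 * + p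
  LowOK⇒a1²<3a2+9p {p} 0<p a1 a2 low with multiple-of-4-bound ∣ a1 ∣ 0<p
  ... | M , 4∣M , bound with LowOK⇒MulSqrtLe-at {p} {a1} {a2} low 4∣M
  ...   | z , y≡+z , sq = *-cancelˡ-<-nonNeg (+ 2) (+-cancelʳ-< (+ 3 * + Q) (begin-strict
    + 2 * (a1 * a1) + + 3 * + Q                       ≡⟨ cong (λ s → + 2 * s + + 3 * + Q) a1²≡ ⟩
    + 2 * + (n ℕ.* n) + + 3 * + Q                     ≡⟨ pos-linear 2 (n ℕ.* n) 3 Q ⟨
    + (2 ℕ.* (n ℕ.* n) ℕ.+ 3 ℕ.* Q)                   <⟨ +<+ (bound z sq) ⟩
    + (3 ℕ.* z ℕ.+ 12 ℕ.* p)                          ≡⟨ pos-linear 3 z 12 p ⟩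
    + 3 * + z + + 12 * + p                            ≡⟨ cong (λ s → + 3 * s + + 12 * + p) y≡+z ⟨
    + 3 * (+ 2 * a2 + + 2 * + p + + Q) + + 12 * + p   ≡⟨ regroup a2 (+ p) (+ Q) ⟩
    + 2 * (+ 3 * a2 + + 9 * + p) + + 3 * + Q          ∎))
    where
    open ≤-Reasoning
    n = ∣ a1 ∣
    Q = M ℕ.* M ℕ.* p
    a1²≡ : a1 * a1 ≡ + (n ℕ.* n)
    a1²≡ = trans (cong (a1 *_) (sym (◃-inverse a1))) (i*[sign[i]◃n]≡+∣i∣*n a1 n)
    regroup : ∀ a p q →
      + 3 * (+ 2 * a + + 2 * p + q) + + 12 * p ≡ + 2 * (+ 3 * a + + 9 * p) + + 3 * q
    regroup = solve-∀

  quotient-window : ∀ U D .{{_ : ℕ.NonZero D}} k q → q * + D ≤ U → U < (q + + k) * + D →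
    q ∈ applyUpTo (λ t → U /ℕ D - + t) k
  quotient-window U D k q qD≤U U<[q+k]D =
    subst (_∈ applyUpTo (λ t → Q - + t) k) Q-t≡q (∈-applyUpTo⁺ (λ t → Q - + t) t<k)
    where
    Q = U /ℕ D
    q≤Q : q ≤ Q
    q≤Q = ≮⇒≥ λ Q<q → <⇒≱ (n<s[n/ℕd]*d U D)
      (≤-trans (*-monoʳ-≤-nonNeg (+ D) (i<j⇒suc[i]≤j Q<q)) qD≤U)
    Q<q+k : Q < q + + k
    Q<q+k = *-cancelʳ-<-nonNeg (+ D) (≤-<-trans ([n/ℕd]*d≤n U D) U<[q+k]D)
    i-j+j≡i : ∀ i j → i - j + j ≡ i
    i-j+j≡i = solve-∀
    i-[i-j]≡j : ∀ i j → i - (i - j) ≡ j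
    i-[i-j]≡j = solve-∀
    Q-q<k : Q - q < + k
    Q-q<k = +-cancelʳ-< q (subst₂ _<_ (sym (i-j+j≡i Q q)) (+-comm q (+ k)) Q<q+k)
    +t≡Q-q : + ∣ Q - q ∣ ≡ Q - q
    +t≡Q-q = 0≤i⇒+∣i∣≡i (i≤j⇒0≤j-i q≤Q)
    t<k : ∣ Q - q ∣ ℕ.< k
    t<k = drop‿+<+ (subst (_< + k) (sym +t≡Q-q) Q-q<k)
    Q-t≡q : Q - + ∣ Q - q ∣ ≡ q
    Q-t≡q = trans (cong (_-_ Q) +t≡Q-q) (i-[i-j]≡j Q q)

  -- 3a2 ∈ (a1² - 9p, a1² + 9p] forces (a2 - r)/p to be one of the six largest integers ≤ U/3p.
  candidates : (p : ℕ.ℕ) .{{_ : ℕ.NonZero p}} → ℤ → ℤ → List ℤ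
  candidates p a1 r = map (λ q → r + q * + p) (applyUpTo (λ t → U /ℕ (3 ℕ.* p) - + t) 6)
    where
    instance _ = ℕ.m*n≢0 3 p
    U = + 9 * + p - + 3 * r + a1 * a1

  window⇒∈candidates : ∀ {p} .{{_ : ℕ.NonZero p}} a1 r {a2} q → a2 ≡ r + q * + p →
    + 3 * a2 ≤ + 9 * + p + a1 * a1 → a1 * a1 < + 3 * a2 + + 9 * + p → a2 ∈ candidates p a1 r
  window⇒∈candidates {p} a1 r q refl 3a2≤ <3a2 =
    ∈-map⁺ (λ q → r + q * + p) (quotient-window U (3 ℕ.* p) 6 q below above)
    where
    instance _ = ℕ.m*n≢0 3 p
    U = + 9 * + p - + 3 * r + a1 * a1
    3p≡ : + 3 * + p ≡ + (3 ℕ.* p)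
    3p≡ = sym (pos-* 3 p)
    below : q * + (3 ℕ.* p) ≤ U
    below = begin
      q * + (3 ℕ.* p)                     ≡⟨ cong (q *_) 3p≡ ⟨
      q * (+ 3 * + p)                     ≡⟨ q[3p]≡-3r+3[r+qp] q r (+ p) ⟩
      - (+ 3 * r) + + 3 * (r + q * + p)   ≤⟨ +-monoʳ-≤ (- (+ 3 * r)) 3a2≤ ⟩
      - (+ 3 * r) + (+ 9 * + p + a1 * a1) ≡⟨ -3r+[9p+a]≡9p-3r+a (+ p) r (a1 * a1) ⟩
      U                                   ∎
      where
      open ≤-Reasoning
      q[3p]≡-3r+3[r+qp] : ∀ q r p → q * (+ 3 * p) ≡ - (+ 3 * r) + + 3 * (r + q * p)
      q[3p]≡-3r+3[r+qp] = solve-∀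
      -3r+[9p+a]≡9p-3r+a : ∀ p r a → - (+ 3 * r) + (+ 9 * p + a) ≡ + 9 * p - + 3 * r + a
      -3r+[9p+a]≡9p-3r+a = solve-∀
    above : U < (q + + 6) * + (3 ℕ.* p)
    above = begin-strict
      U                                     <⟨ +-monoʳ-< (+ 9 * + p - + 3 * r) <3a2 ⟩
      + 9 * + p - + 3 * r + (+ 3 * (r + q * + p) + + 9 * + p)
                                            ≡⟨ 9p-3r+[3[r+qp]+9p]≡[q+6][3p] q r (+ p) ⟩
      (q + + 6) * (+ 3 * + p)               ≡⟨ cong ((q + + 6) *_) 3p≡ ⟩
      (q + + 6) * + (3 ℕ.* p)               ∎
      where
      open ≤-Reasoning
      9p-3r+[3[r+qp]+9p]≡[q+6][3p] : ∀ q r p →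
        + 9 * p - + 3 * r + (+ 3 * (r + q * p) + + 9 * p) ≡ (q + + 6) * (+ 3 * p)
      9p-3r+[3[r+qp]+9p]≡[q+6][3p] = solve-∀

  admissible⇒∈candidates : ∀ {p} .{{_ : ℕ.NonZero p}} a1 r {a2} →
    Admissible p a1 r a2 → a2 ∈ candidates p a1 r
  admissible⇒∈candidates {p} a1 r {a2} (p∣a2-r , low , high) with ∣ᵤ⇒∣ p∣a2-r
  ... | divides q a2-r≡qp =
    window⇒∈candidates a1 r q a2≡r+qp high (LowOK⇒a1²<3a2+9p (ℕ.>-nonZero⁻¹ p) a1 a2 low)
    where
    a≡r+[a-r] : ∀ a r → a ≡ r + (a - r)
    a≡r+[a-r] = solve-∀
    a2≡r+qp : a2 ≡ r + q * + p
    a2≡r+qp = trans (a≡r+[a-r] a2 r) (cong (_+_ r) a2-r≡qp)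

open import Data.Nat using (ℕ; _≤_; suc; z≤n; s≤s)
open import Data.Nat.Properties using (module ≤-Reasoning)
open import Data.Nat.Primality using (Prime; prime⇒nonZero)
open import Data.Integer using (ℤ)
open import Data.List.Properties using (length-removeAt′)
open import Data.List.Relation.Unary.All as All using (All)
open import Data.List.Relation.Unary.Any using (here; there; index)
open import Data.List.Relation.Unary.AllPairs using (_∷_)
open import Data.List.Relation.Unary.Unique.Propositional using (Unique)
open import Data.List.Relation.Binary.Subset.Propositional using (_⊆_)
open ℤ-Bounds using (candidates; admissible⇒∈candidates)

∈-─ : ∀ {A : Set} {x y : A} {ys} (x∈ys : x ∈ ys) → y ∈ ys → x ≢ y → y ∈ ys ─ x∈ys
∈-─ (here refl) (here refl)  x≢y = contradiction refl x≢y
∈-─ (here _)    (there y∈ys) _   = y∈ys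
∈-─ (there _)   (here y≡z)   _   = here y≡z
∈-─ (there x∈ys) (there y∈ys) x≢y = there (∈-─ x∈ys y∈ys x≢y)

Unique⇒length≤ : ∀ {A : Set} {xs ys : List A} → Unique xs → xs ⊆ ys → length xs ≤ length ys
Unique⇒length≤ {xs = []}     _           _        = z≤n
Unique⇒length≤ {xs = x ∷ xs} {ys} (x∉xs ∷ xs!) x∷xs⊆ys = begin
  suc (length xs)          ≤⟨ s≤s (Unique⇒length≤ xs! xs⊆ys─x) ⟩
  suc (length (ys ─ x∈ys)) ≡⟨ length-removeAt′ ys (index x∈ys) ⟨
  length ys                ∎
  where
  open ≤-Reasoning
  x∈ys = x∷xs⊆ys (here refl)
  xs⊆ys─x : xs ⊆ ys ─ x∈ys
  xs⊆ys─x y∈xs = ∈-─ x∈ys (x∷xs⊆ys (there y∈xs)) (All.lookup x∉xs y∈xs)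

mainTheorem2 : (p : ℕ) → Prime p → (a1 r : ℤ) → (xs : List ℤ) → Unique xs →
    All (Admissible p a1 r) xs → length xs ≤ 6
mainTheorem2 p p-prime a1 r xs xs! admissible = begin
  length xs                  ≤⟨ Unique⇒length≤ xs! xs⊆candidates ⟩
  length (candidates p a1 r) ≡⟨⟩
  6                          ∎
  where
  open ≤-Reasoning
  instance _ = prime⇒nonZero p-prime
  xs⊆candidates : xs ⊆ candidates p a1 r
  xs⊆candidates a2∈xs = admissible⇒∈candidates a1 r (All.lookup admissible a2∈xs)
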